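{- Let $(K,T,+,;,{}^*,\rightarrow,0,1)$ be an idempotent graded Kleene algebra with tests (I-GKAT) that additionally satisfies $(a+b)\rightarrow 0=(a\rightarrow 0);(b\rightarrow 0)$ for all $a,b\in T$. Then for all $b,c\in T$ and $p,q\in K$, $$(b;p;(c;q)^*;(c\rightarrow0))^*;(b\rightarrow0)\;=\;b;p;\big((b+c);(c;q+(c\rightarrow0);p)\big)^*;((b+c)\rightarrow0)+(b\rightarrow0).$$ That is, the program "while $b$ do begin $p$; while $c$ do $q$ end" is equivalent to "if $b$ then begin $p$; while $b+c$ do (if $c$ then $q$ else $p$) end".
   Context: A graded Kleene algebra with tests (GKAT) is a tuple $(K,T,+,;,{}^*,\rightarrow,0,1)$ where $K$ is a set, $T\subseteq K$, $0,1\in T$, $+$ and $;$ are binary operations on $K$ under which $T$ is closed, ${}^*$ is unary on $K$, and $\rightarrow$ is a binary operation on $T$ with values in $T$, such that for all $p,q,r\in K$ and $a,b,c\in T$: $p+(q+r)=(p+q)+r$; $p+q=q+p$; $p;(q;r)=(p;q);r$; $p;1=1;p=p$; $p;(q+r)=p;q+p;r$; $(p+q);r=p;r+q;r$; $p;0=0;p=0$; $1+p;p^*=p^*$; $q+p;r\leq r\Rightarrow p^*;q\leq r$; $q+r;p\leq r\Rightarrow q;p^*\leq r$; $a;b\leq c\Leftrightarrow b\leq a\rightarrow c$; $a\leq 1$; $a;b=b;a$, where $p\leq q$ means $p+q=q$. An I-GKAT is a GKAT additionally satisfying $a;a=a$ for all $a\in T$. Program encodings: "if $b$ then $p$ else $q$"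 is $b;p+(b\rightarrow0);q$; "if $b$ then $p$" is $b;p+(b\rightarrow 0)$; "while $b$ do $p$" is $(b;p)^*;(b\rightarrow0)$. -}

module Defs where

open import Level using (Level; suc; _⊔_)
open import Data.Product using (Σ; _,_; proj₁)
open import Relation.Binary.PropositionalEquality using (_≡_)

record GKAT (c ℓ : Level) : Set (suc (c ⊔ ℓ)) where
  infixl 6 _+_
  infixl 7 _⨾_
  infix 4 _≤_
  field
    K    : Set c
    Test : K → Set ℓ
    _+_  : K → K → K
    _⨾_  : K → K → K
    _⋆   : K → K
    𝟘 𝟙  : K
    𝟘-test : Test 𝟘
    𝟙-test : Test 𝟙
    +-test : ∀ {a b} → Test a → Test b → Test (a + b)
    ⨾-test : ∀ {a b} → Test a → Test b → Test (a ⨾ b)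

  T : Set (c ⊔ ℓ)
  T = Σ K Test

  _≤_ : K → K → Set c
  p ≤ q = p + q ≡ q

  field
    _⇒_ : T → T → T

    +-assoc : ∀ p q r → p + (q + r) ≡ (p + q) + r
    +-comm  : ∀ p q → p + q ≡ q + p
    ⨾-assoc : ∀ p q r → p ⨾ (q ⨾ r) ≡ (p ⨾ q) ⨾ r
    ⨾-identityʳ : ∀ p → p ⨾ 𝟙 ≡ p
    ⨾-identityˡ : ∀ p → 𝟙 ⨾ p ≡ p
    distribˡ : ∀ p q r → p ⨾ (q + r) ≡ p ⨾ q + p ⨾ r
    distribʳ : ∀ p q r → (p + q) ⨾ r ≡ p ⨾ r + q ⨾ r
    zeroʳ : ∀ p → p ⨾ 𝟘 ≡ 𝟘
    zeroˡ : ∀ p → 𝟘 ⨾ p ≡ 𝟘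
    star-unfold : ∀ p → 𝟙 + p ⨾ (p ⋆) ≡ p ⋆
    star-indˡ : ∀ p q r → q + p ⨾ r ≤ r → (p ⋆) ⨾ q ≤ r
    star-indʳ : ∀ p q r → q + r ⨾ p ≤ r → q ⨾ (p ⋆) ≤ r
    residual-⇒ : ∀ (a b c : T) → proj₁ a ⨾ proj₁ b ≤ proj₁ c → proj₁ b ≤ proj₁ (a ⇒ c)
    residual-⇐ : ∀ (a b c : T) → proj₁ b ≤ proj₁ (a ⇒ c) → proj₁ a ⨾ proj₁ b ≤ proj₁ c
    test-≤𝟙 : ∀ (a : T) → proj₁ a ≤ 𝟙
    test-comm : ∀ (a b : T) → proj₁ a ⨾ proj₁ b ≡ proj₁ b ⨾ proj₁ a

  𝟘ₜ : T
  𝟘ₜ = 𝟘 , 𝟘-test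

  _+ₜ_ : T → T → T
  (a , ta) +ₜ (b , tb) = a + b , +-test ta tb

  ¬ₜ : T → K
  ¬ₜ a = proj₁ (a ⇒ 𝟘ₜ)


IsIdempotent : ∀ {c ℓ} → GKAT c ℓ → Set (c ⊔ ℓ)
IsIdempotent G = ∀ (a : T) → proj₁ a ⨾ proj₁ a ≡ proj₁ a
  where open GKAT G

DeMorgan : ∀ {c ℓ} → GKAT c ℓ → Set (c ⊔ ℓ)
DeMorgan G = ∀ (a b : T) → ¬ₜ (a +ₜ b) ≡ ¬ₜ a ⨾ ¬ₜ b
  where open GKAT G

-- Each inclusion is a single star induction. Under the guard b + c the merged body
-- (if c then q else p) equals c;q + b;¬c;p (this is where c;c = c is needed), and the
-- exit test ¬(b + c) factors as ¬c;¬b. Hence the merged loop after the first b;p is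
-- bounded by (c;q)*;¬c;lhs, the remainder of a run of the nested loops; conversely the
-- right-hand side absorbs one outer iteration b;p;(c;q)*;¬c, since the inner loop
-- followed by ¬c and the right-hand side stays inside the merged loop.
module Submission where

open import Defs
open import Level using (Level)
open import Data.Product using (proj₁; _,_)
open import Relation.Binary.Bundles using (Poset)
open import Relation.Binary.PropositionalEquality
  using (_≡_; refl; sym; trans; cong; cong₂; isEquivalence; module ≡-Reasoning)
import Relation.Binary.Reasoning.PartialOrder as PosetReasoning

module GKATProperties {c ℓ : Level} (G : GKAT c ℓ) where
  open GKAT G

  1ₜ : T
  1ₜ = 𝟙 , 𝟙-test

  +-idem : ∀ p → p + p ≡ p
  +-idem p = begin
    p + p             ≡⟨ cong₂ _+_ (⨾-identityʳ p) (⨾-identityʳ p) ⟨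
    p ⨾ 𝟙 + p ⨾ 𝟙     ≡⟨ distribˡ p 𝟙 𝟙 ⟨
    p ⨾ (𝟙 + 𝟙)       ≡⟨ cong (p ⨾_) (test-≤𝟙 1ₜ) ⟩
    p ⨾ 𝟙             ≡⟨ ⨾-identityʳ p ⟩
    p                 ∎
    where open ≡-Reasoning

  +-identityˡ : ∀ p → 𝟘 + p ≡ p
  +-identityˡ p = begin
    𝟘 + p             ≡⟨ cong₂ _+_ (zeroʳ p) (⨾-identityʳ p) ⟨
    p ⨾ 𝟘 + p ⨾ 𝟙     ≡⟨ distribˡ p 𝟘 𝟙 ⟨
    p ⨾ (𝟘 + 𝟙)       ≡⟨ cong (p ⨾_) (test-≤𝟙 𝟘ₜ) ⟩
    p ⨾ 𝟙             ≡⟨ ⨾-identityʳ p ⟩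
    p                 ∎
    where open ≡-Reasoning

  +-identityʳ : ∀ p → p + 𝟘 ≡ p
  +-identityʳ p = trans (+-comm p 𝟘) (+-identityˡ p)

  ≤-trans : ∀ {p q r} → p ≤ q → q ≤ r → p ≤ r
  ≤-trans {p} {q} {r} p≤q q≤r = begin
    p + r             ≡⟨ cong (p +_) q≤r ⟨
    p + (q + r)       ≡⟨ +-assoc p q r ⟩
    p + q + r         ≡⟨ cong (_+ r) p≤q ⟩
    q + r             ≡⟨ q≤r ⟩
    r                 ∎
    where open ≡-Reasoning

  ≤-antisym : ∀ {p q} → p ≤ q → q ≤ p → p ≡ q
  ≤-antisym {p} {q} p≤q q≤p = trans (sym q≤p) (trans (+-comm q p) p≤q)

  ≤-poset : Poset c c c
  ≤-poset = record
    { Carrier        = K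
    ; _≈_            = _≡_
    ; _≤_            = _≤_
    ; isPartialOrder = record
      { isPreorder = record
        { isEquivalence = isEquivalence
        ; reflexive     = λ { refl → +-idem _ }
        ; trans         = ≤-trans
        }
      ; antisym    = ≤-antisym
      }
    }

  module ≤-Reasoning = PosetReasoning ≤-poset
  open ≤-Reasoning

  x≤x+y : ∀ p q → p ≤ p + q
  x≤x+y p q = trans (+-assoc p p q) (cong (_+ q) (+-idem p))

  y≤x+y : ∀ p q → q ≤ p + q
  y≤x+y p q = begin
    q                 ≤⟨ x≤x+y q p ⟩
    q + p             ≡⟨ +-comm q p ⟩
    p + q             ∎

  +-least : ∀ {p q r} → p ≤ r → q ≤ r → p + q ≤ r
  +-least {p} {q} {r} p≤r q≤r = trans (sym (+-assoc p q r)) (trans (cong (p +_) q≤r) p≤r)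

  ⨾-monoʳ-≤ : ∀ p {q r} → q ≤ r → p ⨾ q ≤ p ⨾ r
  ⨾-monoʳ-≤ p {q} {r} q≤r = trans (sym (distribˡ p q r)) (cong (p ⨾_) q≤r)

  ⨾-monoˡ-≤ : ∀ r {p q} → p ≤ q → p ⨾ r ≤ q ⨾ r
  ⨾-monoˡ-≤ r {p} {q} p≤q = trans (sym (distribʳ p q r)) (cong (_⨾ r) p≤q)

  ⋆-⨾-unfold : ∀ p q → q + p ⨾ (p ⋆ ⨾ q) ≡ p ⋆ ⨾ q
  ⋆-⨾-unfold p q = begin-equality
    q + p ⨾ (p ⋆ ⨾ q)       ≡⟨ cong₂ _+_ (⨾-identityˡ q) (sym (⨾-assoc p (p ⋆) q)) ⟨
    𝟙 ⨾ q + p ⨾ p ⋆ ⨾ q     ≡⟨ distribʳ 𝟙 (p ⨾ p ⋆) q ⟨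
    (𝟙 + p ⨾ p ⋆) ⨾ q       ≡⟨ cong (_⨾ q) (star-unfold p) ⟩
    p ⋆ ⨾ q                 ∎

  q≤p⋆⨾q : ∀ p q → q ≤ p ⋆ ⨾ q
  q≤p⋆⨾q p q = begin
    q                       ≤⟨ x≤x+y q _ ⟩
    q + p ⨾ (p ⋆ ⨾ q)       ≡⟨ ⋆-⨾-unfold p q ⟩
    p ⋆ ⨾ q                 ∎

  p⨾p⋆⨾q≤p⋆⨾q : ∀ p q → p ⨾ (p ⋆ ⨾ q) ≤ p ⋆ ⨾ q
  p⨾p⋆⨾q≤p⋆⨾q p q = begin
    p ⨾ (p ⋆ ⨾ q)           ≤⟨ y≤x+y q _ ⟩
    q + p ⨾ (p ⋆ ⨾ q)       ≡⟨ ⋆-⨾-unfold p q ⟩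
    p ⋆ ⨾ q                 ∎

  test-⨾-≤ : ∀ (a : T) p → proj₁ a ⨾ p ≤ p
  test-⨾-≤ a p = begin
    proj₁ a ⨾ p             ≤⟨ ⨾-monoˡ-≤ p (test-≤𝟙 a) ⟩
    𝟙 ⨾ p                   ≡⟨ ⨾-identityˡ p ⟩
    p                       ∎

  test-⨾-¬ₜ : ∀ (a : T) → proj₁ a ⨾ ¬ₜ a ≡ 𝟘
  test-⨾-¬ₜ a = trans (sym (+-identityʳ _)) (residual-⇐ a (a ⇒ 𝟘ₜ) 𝟘ₜ (+-idem _))

  +ₜ-⨾-absorbs : IsIdempotent G → ∀ (b c : T) → proj₁ (b +ₜ c) ⨾ proj₁ c ≡ proj₁ c
  +ₜ-⨾-absorbs idem b c = begin-equality
    proj₁ (b +ₜ c) ⨾ C      ≡⟨ distribʳ (proj₁ b) C C ⟩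
    proj₁ b ⨾ C + C ⨾ C     ≡⟨ cong (proj₁ b ⨾ C +_) (idem c) ⟩
    proj₁ b ⨾ C + C         ≡⟨ test-⨾-≤ b C ⟩
    C                       ∎
    where C = proj₁ c

  +ₜ-⨾-¬ₜ : ∀ (b c : T) → proj₁ (b +ₜ c) ⨾ ¬ₜ c ≡ proj₁ b ⨾ ¬ₜ c
  +ₜ-⨾-¬ₜ b c = begin-equality
    proj₁ (b +ₜ c) ⨾ ¬ₜ c               ≡⟨ distribʳ (proj₁ b) (proj₁ c) (¬ₜ c) ⟩
    proj₁ b ⨾ ¬ₜ c + proj₁ c ⨾ ¬ₜ c     ≡⟨ cong (proj₁ b ⨾ ¬ₜ c +_) (test-⨾-¬ₜ c) ⟩
    proj₁ b ⨾ ¬ₜ c + 𝟘                  ≡⟨ +-identityʳ _ ⟩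
    proj₁ b ⨾ ¬ₜ c                      ∎

  +ₜ-⨾-if : IsIdempotent G → ∀ (b c : T) p q →
    proj₁ (b +ₜ c) ⨾ (proj₁ c ⨾ q + ¬ₜ c ⨾ p) ≡ proj₁ c ⨾ q + proj₁ b ⨾ ¬ₜ c ⨾ p
  +ₜ-⨾-if idem b c p q = begin-equality
    D ⨾ (proj₁ c ⨾ q + ¬ₜ c ⨾ p)        ≡⟨ distribˡ D (proj₁ c ⨾ q) (¬ₜ c ⨾ p) ⟩
    D ⨾ (proj₁ c ⨾ q) + D ⨾ (¬ₜ c ⨾ p)  ≡⟨ cong₂ _+_ (⨾-assoc D (proj₁ c) q) (⨾-assoc D (¬ₜ c) p) ⟩
    D ⨾ proj₁ c ⨾ q + D ⨾ ¬ₜ c ⨾ p      ≡⟨ cong₂ _+_ (cong (_⨾ q) (+ₜ-⨾-absorbs idem b c))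
                                                    (cong (_⨾ p) (+ₜ-⨾-¬ₜ b c)) ⟩
    proj₁ c ⨾ q + proj₁ b ⨾ ¬ₜ c ⨾ p    ∎
    where D = proj₁ (b +ₜ c)

  ¬ₜ-+ₜ : DeMorgan G → ∀ (b c : T) → ¬ₜ (b +ₜ c) ≡ ¬ₜ c ⨾ ¬ₜ b
  ¬ₜ-+ₜ dm b c = trans (dm b c) (test-comm (b ⇒ 𝟘ₜ) (c ⇒ 𝟘ₜ))

  module WhileInWhile (idem : IsIdempotent G) (dm : DeMorgan G) (b c : T) (p q : K) where

    B C ¬b ¬c D ¬d : K
    B  = proj₁ b
    C  = proj₁ c
    ¬b = ¬ₜ b
    ¬c = ¬ₜ c
    D  = proj₁ (b +ₜ c)
    ¬d = ¬ₜ (b +ₜ c)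

    inner outer-body merged-body merged lhs rhs : K
    inner       = (C ⨾ q) ⋆
    outer-body  = B ⨾ p ⨾ inner ⨾ ¬c
    merged-body = D ⨾ (C ⨾ q + ¬c ⨾ p)
    merged      = merged-body ⋆ ⨾ ¬d
    lhs         = outer-body ⋆ ⨾ ¬b
    rhs         = B ⨾ p ⨾ merged + ¬b

    merged-body-split : merged-body ≡ C ⨾ q + B ⨾ ¬c ⨾ p
    merged-body-split = +ₜ-⨾-if idem b c p q

    outer-body-⨾ : ∀ z → outer-body ⨾ z ≡ B ⨾ p ⨾ (inner ⨾ (¬c ⨾ z))
    outer-body-⨾ z = begin-equality
      B ⨾ p ⨾ inner ⨾ ¬c ⨾ z          ≡⟨ ⨾-assoc (B ⨾ p ⨾ inner) ¬c z ⟨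
      B ⨾ p ⨾ inner ⨾ (¬c ⨾ z)        ≡⟨ ⨾-assoc (B ⨾ p) inner (¬c ⨾ z) ⟨
      B ⨾ p ⨾ (inner ⨾ (¬c ⨾ z))      ∎

    ¬c-⨾-guarded : ∀ z → ¬c ⨾ (B ⨾ p ⨾ z) ≡ B ⨾ ¬c ⨾ p ⨾ z
    ¬c-⨾-guarded z = begin-equality
      ¬c ⨾ (B ⨾ p ⨾ z)        ≡⟨ ⨾-assoc ¬c (B ⨾ p) z ⟩
      ¬c ⨾ (B ⨾ p) ⨾ z        ≡⟨ cong (_⨾ z) (⨾-assoc ¬c B p) ⟩
      ¬c ⨾ B ⨾ p ⨾ z          ≡⟨ cong (λ s → s ⨾ p ⨾ z) (test-comm (c ⇒ 𝟘ₜ) b) ⟩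
      B ⨾ ¬c ⨾ p ⨾ z          ∎

    C⨾q≤merged-body : C ⨾ q ≤ merged-body
    C⨾q≤merged-body = begin
      C ⨾ q                   ≤⟨ x≤x+y _ _ ⟩
      C ⨾ q + B ⨾ ¬c ⨾ p      ≡⟨ merged-body-split ⟨
      merged-body             ∎

    B⨾¬c⨾p≤merged-body : B ⨾ ¬c ⨾ p ≤ merged-body
    B⨾¬c⨾p≤merged-body = begin
      B ⨾ ¬c ⨾ p              ≤⟨ y≤x+y _ _ ⟩
      C ⨾ q + B ⨾ ¬c ⨾ p      ≡⟨ merged-body-split ⟨
      merged-body             ∎

    merged-step : ∀ {s} → s ≤ merged-body → s ⨾ merged ≤ merged
    merged-step {s} s≤body = begin
      s ⨾ merged              ≤⟨ ⨾-monoˡ-≤ merged s≤body ⟩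
      merged-body ⨾ merged    ≤⟨ p⨾p⋆⨾q≤p⋆⨾q merged-body ¬d ⟩
      merged                  ∎

    ¬c⨾rhs≤merged : ¬c ⨾ rhs ≤ merged
    ¬c⨾rhs≤merged = begin
      ¬c ⨾ (B ⨾ p ⨾ merged + ¬b)          ≡⟨ distribˡ ¬c (B ⨾ p ⨾ merged) ¬b ⟩
      ¬c ⨾ (B ⨾ p ⨾ merged) + ¬c ⨾ ¬b     ≡⟨ cong₂ _+_ (¬c-⨾-guarded merged) (sym (¬ₜ-+ₜ dm b c)) ⟩
      B ⨾ ¬c ⨾ p ⨾ merged + ¬d            ≤⟨ +-least (merged-step B⨾¬c⨾p≤merged-body) (q≤p⋆⨾q merged-body ¬d) ⟩
      merged                              ∎

    inner-exit≤merged : inner ⨾ (¬c ⨾ rhs) ≤ merged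
    inner-exit≤merged = star-indˡ (C ⨾ q) (¬c ⨾ rhs) merged
      (+-least ¬c⨾rhs≤merged (merged-step C⨾q≤merged-body))

    lhs≤rhs : lhs ≤ rhs
    lhs≤rhs = star-indˡ outer-body ¬b rhs (+-least (y≤x+y _ _) (begin
      outer-body ⨾ rhs                ≡⟨ outer-body-⨾ rhs ⟩
      B ⨾ p ⨾ (inner ⨾ (¬c ⨾ rhs))    ≤⟨ ⨾-monoʳ-≤ (B ⨾ p) inner-exit≤merged ⟩
      B ⨾ p ⨾ merged                  ≤⟨ x≤x+y _ _ ⟩
      rhs                             ∎))

    inner-exit-lhs : K
    inner-exit-lhs = inner ⨾ (¬c ⨾ lhs)

    ¬c⨾lhs≤inner-exit-lhs : ¬c ⨾ lhs ≤ inner-exit-lhs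
    ¬c⨾lhs≤inner-exit-lhs = q≤p⋆⨾q (C ⨾ q) (¬c ⨾ lhs)

    merged≤inner-exit-lhs : merged ≤ inner-exit-lhs
    merged≤inner-exit-lhs = star-indˡ merged-body ¬d inner-exit-lhs (+-least exit body)
      where
      exit : ¬d ≤ inner-exit-lhs
      exit = begin
        ¬d                    ≡⟨ ¬ₜ-+ₜ dm b c ⟩
        ¬c ⨾ ¬b               ≤⟨ ⨾-monoʳ-≤ ¬c (q≤p⋆⨾q outer-body ¬b) ⟩
        ¬c ⨾ lhs              ≤⟨ ¬c⨾lhs≤inner-exit-lhs ⟩
        inner-exit-lhs        ∎

      guarded-step : B ⨾ ¬c ⨾ p ⨾ inner-exit-lhs ≤ inner-exit-lhs
      guarded-step = begin
        B ⨾ ¬c ⨾ p ⨾ inner-exit-lhs       ≡⟨ ¬c-⨾-guarded inner-exit-lhs ⟨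
        ¬c ⨾ (B ⨾ p ⨾ inner-exit-lhs)     ≡⟨ cong (¬c ⨾_) (outer-body-⨾ lhs) ⟨
        ¬c ⨾ (outer-body ⨾ lhs)           ≤⟨ ⨾-monoʳ-≤ ¬c (p⨾p⋆⨾q≤p⋆⨾q outer-body ¬b) ⟩
        ¬c ⨾ lhs                          ≤⟨ ¬c⨾lhs≤inner-exit-lhs ⟩
        inner-exit-lhs                    ∎

      body : merged-body ⨾ inner-exit-lhs ≤ inner-exit-lhs
      body = begin
        merged-body ⨾ inner-exit-lhs                          ≡⟨ cong (_⨾ inner-exit-lhs) merged-body-split ⟩
        (C ⨾ q + B ⨾ ¬c ⨾ p) ⨾ inner-exit-lhs                 ≡⟨ distribʳ (C ⨾ q) (B ⨾ ¬c ⨾ p) inner-exit-lhs ⟩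
        C ⨾ q ⨾ inner-exit-lhs + B ⨾ ¬c ⨾ p ⨾ inner-exit-lhs  ≤⟨ +-least (p⨾p⋆⨾q≤p⋆⨾q (C ⨾ q) (¬c ⨾ lhs)) guarded-step ⟩
        inner-exit-lhs                                        ∎

    rhs≤lhs : rhs ≤ lhs
    rhs≤lhs = +-least (begin
      B ⨾ p ⨾ merged                  ≤⟨ ⨾-monoʳ-≤ (B ⨾ p) merged≤inner-exit-lhs ⟩
      B ⨾ p ⨾ inner-exit-lhs          ≡⟨ outer-body-⨾ lhs ⟨
      outer-body ⨾ lhs                ≤⟨ p⨾p⋆⨾q≤p⋆⨾q outer-body ¬b ⟩
      lhs                             ∎) (q≤p⋆⨾q outer-body ¬b)

    lhs≡rhs : lhs ≡ rhs
    lhs≡rhs = ≤-antisym lhs≤rhs rhs≤lhs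

theorem7 : ∀ {c ℓ : Level} (G : GKAT c ℓ) → IsIdempotent G → DeMorgan G →
    let open GKAT G in
    ∀ (b c : T) (p q : K) →
      ((proj₁ b ⨾ p ⨾ ((proj₁ c ⨾ q) ⋆) ⨾ ¬ₜ c) ⋆) ⨾ ¬ₜ b
        ≡ proj₁ b ⨾ p ⨾ ((proj₁ (b +ₜ c) ⨾ (proj₁ c ⨾ q + ¬ₜ c ⨾ p)) ⋆) ⨾ ¬ₜ (b +ₜ c) + ¬ₜ b
theorem7 G idem dm b c p q =
  trans lhs≡rhs (cong (_+ ¬b) (⨾-assoc (B ⨾ p) (merged-body ⋆) ¬d))
  where
  open GKAT G using (_+_; _⨾_; _⋆; ⨾-assoc)
  open GKATProperties.WhileInWhile G idem dm b c p q
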